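{- Let $\mathcal C$ be a category with a terminal object $1$, let $(T,\mu,\eta)$ be a monad and $F$ an endofunctor on $\mathcal C$, and let $\lambda\colon FT\to TF$ be a distributive law of $T$ over $F$. If $T$ is affine (i.e. $\eta_1\colon1\to T1$ is an isomorphism), then $\lambda$ is $\omega$-suitable, i.e. for every object $X$, $TF(!_X)\circ\lambda_X=\eta_{F1}\circ F(!_{TX})\colon FTX\to TF1$.
   Context: A distributive law $\lambda\colon FT\to TF$ is a natural transformation with $\lambda\circ F\mu=\mu_F\circ T\lambda\circ\lambda_T$ and $\lambda\circ F\eta=\eta_F$. $!_Y$ denotes the unique morphism $Y\to1$. -}

module Defs where

open import Level using (Level; _⊔_; suc)
open import Relation.Binary using (IsEquivalence)
open import Data.Product using (Σ; _×_; _,_)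

record Category (o ℓ e : Level) : Set (suc (o ⊔ ℓ ⊔ e)) where
  infixr 9 _∘_
  infix  4 _≈_
  infixr 5 _⇒_
  field
    Obj   : Set o
    _⇒_   : Obj → Obj → Set ℓ
    _≈_   : ∀ {A B} → A ⇒ B → A ⇒ B → Set e
    id    : ∀ {A} → A ⇒ A
    _∘_   : ∀ {A B C} → B ⇒ C → A ⇒ B → A ⇒ C
    assoc     : ∀ {A B C D} {f : A ⇒ B} {g : B ⇒ C} {h : C ⇒ D} →
                (h ∘ g) ∘ f ≈ h ∘ (g ∘ f)
    identityˡ : ∀ {A B} {f : A ⇒ B} → id ∘ f ≈ f
    identityʳ : ∀ {A B} {f : A ⇒ B} → f ∘ id ≈ f
    equiv     : ∀ {A B} → IsEquivalence (_≈_ {A} {B})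
    ∘-resp-≈  : ∀ {A B C} {f h : B ⇒ C} {g i : A ⇒ B} →
                f ≈ h → g ≈ i → f ∘ g ≈ h ∘ i

module _ {o ℓ e : Level} (C : Category o ℓ e) where
  open Category C

  record Endofunctor : Set (o ⊔ ℓ ⊔ e) where
    field
      F₀ : Obj → Obj
      F₁ : ∀ {A B} → A ⇒ B → F₀ A ⇒ F₀ B
      identity     : ∀ {A} → F₁ (id {A}) ≈ id
      homomorphism : ∀ {A B C'} {f : A ⇒ B} {g : B ⇒ C'} →
                     F₁ (g ∘ f) ≈ F₁ g ∘ F₁ f
      F-resp-≈     : ∀ {A B} {f g : A ⇒ B} → f ≈ g → F₁ f ≈ F₁ g

  record Monad : Set (o ⊔ ℓ ⊔ e) where
    field
      T : Endofunctor
    open Endofunctor T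
    field
      η : ∀ X → X ⇒ F₀ X
      μ : ∀ X → F₀ (F₀ X) ⇒ F₀ X
      η-natural : ∀ {X Y} (f : X ⇒ Y) → η Y ∘ f ≈ F₁ f ∘ η X
      μ-natural : ∀ {X Y} (f : X ⇒ Y) → μ Y ∘ F₁ (F₁ f) ≈ F₁ f ∘ μ X
      μ-assoc    : ∀ {X} → μ X ∘ F₁ (μ X) ≈ μ X ∘ μ (F₀ X)
      μ-identityˡ : ∀ {X} → μ X ∘ F₁ (η X) ≈ id
      μ-identityʳ : ∀ {X} → μ X ∘ η (F₀ X) ≈ id

  record DistributiveLaw (M : Monad) (F : Endofunctor) : Set (o ⊔ ℓ ⊔ e) where
    open Monad M
    module T = Endofunctor T
    module F = Endofunctor F
    field
      lam : ∀ X → F.F₀ (T.F₀ X) ⇒ T.F₀ (F.F₀ X)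
      natural : ∀ {X Y} (f : X ⇒ Y) →
                lam Y ∘ F.F₁ (T.F₁ f) ≈ T.F₁ (F.F₁ f) ∘ lam X
      law-μ : ∀ X → lam X ∘ F.F₁ (μ X) ≈ μ (F.F₀ X) ∘ (T.F₁ (lam X) ∘ lam (T.F₀ X))
      law-η : ∀ X → lam X ∘ F.F₁ (η X) ≈ η (F.F₀ X)

  record Terminal : Set (o ⊔ ℓ ⊔ e) where
    field
      ⊤  : Obj
      !  : ∀ {X} → X ⇒ ⊤
      !-unique : ∀ {X} (f : X ⇒ ⊤) → ! ≈ f

  IsIso : ∀ {A B} → A ⇒ B → Set (ℓ ⊔ e)
  IsIso {A} {B} f = Σ (B ⇒ A) λ g → (g ∘ f ≈ id) × (f ∘ g ≈ id)

  Affine : Terminal → Monad → Set (ℓ ⊔ e)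
  Affine t M = IsIso (Monad.η M (Terminal.⊤ t))

  ωSuitable : (t : Terminal) (M : Monad) (F : Endofunctor) →
              DistributiveLaw M F → Set (o ⊔ e)
  ωSuitable t M F d = ∀ X →
      T.F₁ (F.F₁ (! {X})) ∘ lam X ≈ η (F.F₀ ⊤) ∘ F.F₁ (! {T.F₀ X})
    where
      open Terminal t
      open Monad M
      open DistributiveLaw d

{-# OPTIONS --safe #-}
module Submission where

-- If η₁ is invertible then T1 is again terminal, so T(!_X) = η₁ ∘ !_{TX}.
-- Feeding this through naturality of λ and the unit law λ ∘ Fη = η_F
-- turns TF(!_X) ∘ λ_X into η_{F1} ∘ F(!_{TX}).

open import Level using (Level)
open import Data.Product using (_,_)
open import Relation.Binary using (Setoid)
import Relation.Binary.Reasoning.Setoid as SetoidReasoning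
open import Defs

module HomReasoning {o ℓ e : Level} (C : Category o ℓ e) where
  open Category C

  hom-setoid : Obj → Obj → Setoid ℓ e
  hom-setoid A B = record { Carrier = A ⇒ B ; _≈_ = _≈_ ; isEquivalence = equiv }

  open module HomSetoid {A B : Obj} = Setoid (hom-setoid A B) public using (refl)
  open module Reasoning {A B : Obj} = SetoidReasoning (hom-setoid A B) public

module _ {o ℓ e : Level} {C : Category o ℓ e} where
  open Category C
  open HomReasoning C

  retraction∘!-unique : (t : Terminal C) → let open Terminal t in
                        ∀ {A B} {h : ⊤ ⇒ B} {g : B ⇒ ⊤} → h ∘ g ≈ id →
                        (f : A ⇒ B) → f ≈ h ∘ !
  retraction∘!-unique t {h = h} {g} h∘g≈id f = begin
    f            ≈⟨ identityˡ ⟨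
    id ∘ f       ≈⟨ ∘-resp-≈ h∘g≈id refl ⟨
    (h ∘ g) ∘ f  ≈⟨ assoc ⟩
    h ∘ (g ∘ f)  ≈⟨ ∘-resp-≈ refl (!-unique (g ∘ f)) ⟨
    h ∘ !        ∎
    where open Terminal t

  module _ {M : Monad C} {F : Endofunctor C} (d : DistributiveLaw C M F) where
    open Monad M
    open DistributiveLaw d

    TF₁∘lam-through-η : ∀ {X Y} {f : X ⇒ Y} {g : T.F₀ X ⇒ Y} →
                        T.F₁ f ≈ η Y ∘ g →
                        T.F₁ (F.F₁ f) ∘ lam X ≈ η (F.F₀ Y) ∘ F.F₁ g
    TF₁∘lam-through-η {X} {Y} {f} {g} Tf≈η∘g = begin
      T.F₁ (F.F₁ f) ∘ lam X          ≈⟨ natural f ⟨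
      lam Y ∘ F.F₁ (T.F₁ f)          ≈⟨ ∘-resp-≈ refl (F.F-resp-≈ Tf≈η∘g) ⟩
      lam Y ∘ F.F₁ (η Y ∘ g)         ≈⟨ ∘-resp-≈ refl F.homomorphism ⟩
      lam Y ∘ (F.F₁ (η Y) ∘ F.F₁ g)  ≈⟨ assoc ⟨
      (lam Y ∘ F.F₁ (η Y)) ∘ F.F₁ g  ≈⟨ ∘-resp-≈ (law-η Y) refl ⟩
      η (F.F₀ Y) ∘ F.F₁ g            ∎

mainTheorem14 : {o ℓ e : Level} (C : Category o ℓ e) (t : Terminal C)
                (M : Monad C) (F : Endofunctor C) (d : DistributiveLaw C M F) →
                Affine C t M → ωSuitable C t M F d
mainTheorem14 C t M F d (_ , _ , η∘η⁻¹≈id) X =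
  TF₁∘lam-through-η d (retraction∘!-unique t η∘η⁻¹≈id (T.F₁ !))
  where
    open Terminal t
    open DistributiveLaw d
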